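{- Consider four robots executing the algorithm $\mathcal A$ below on a ring of $n>8$ nodes. If the configuration at instant $t$ contains neither a $4$-segment nor a tower, then the configuration at instant $t+1$ contains no tower.
   Context: Model. A ring has $n$ nodes $u_0,\dots,u_{n-1}$ (indices mod $n$), $u_i$ adjacent to $u_{i\pm1}$; nodes anonymous, ring unoriented. Robots are anonymous, uniform, oblivious, non-communicating, and repeatedly run Look–Compute–Move cycles: they see the number of robots on each node (multiplicity detection) relative to their own node and up to orientation, compute (possibly randomly) whether to stay or move to a neighboring node, and move. If a robot's view is symmetric under reversing orientation and it moves, an adversary chooses the edge. At each instant $t=0,1,\dots$ a nonempty set of robots (chosen by a distributed fair scheduler: any nonempty subset, every robot infinitely often) performs a full cycle atomically. A tower is a node with at least two robots; initial configurations are towerless. Definitions. A segment is a maximal nonempty path of occupied nodes; an $x$-segment is one with $x$ nodes; an isolated robot/node is one forming a $1$-segment. A hole is a maximal nonempty path of free nodes; an $x$-hole has $x$ nodes; a neighbor of a hole is a node (or robot on it) not in the hole adjacent to one of its end nodes (extremities). An arrow is a maximal path $u_i,\dots,u_m$ of at least four nodes such that $u_i$ and $u_m$ each hold one robot, $u_{i+1},\dots,u_{m-2}$ are free, and $u_{m-1}$ holds a tower of two robots; $u_i$ is the tail, $u_m$ the head; its size is the number of its free nodes (path length minus 3). An arrow is primary if its size is $1$ and final if its size is $n-4$. "Move" means deterministically move; "try to move" means toss a fair coin and move iff it wins. Algorithm $\mathcal A$ (executed by each activated robot): if the robots form a final arrow, do nothing. Otherwise, if the configuration contains neither an arrow nor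 a $4$-segment, execute Phase I; else if it contains a $4$-segment execute Phase II; else (it contains an arrow) execute Phase III. Phase I: (a) If there is a $3$-segment, the isolated robot moves toward the $3$-segment through the shortest hole. (b) Else if there is a unique $2$-segment (two robots isolated), each isolated robot at the closest distance from the $2$-segment moves toward the $2$-segment through the hole having it and an extremity of the $2$-segment as neighbors. (c) Else if there are exactly two $2$-segments, each robot that is a neighbor of a longest hole tries to move toward the other $2$-segment through its neighboring hole. (d) Else (four isolated robots), let $l_{max}$ be the length of the longest hole: if every robot is a neighbor of an $l_{max}$-hole, each tries to move through a neighboring $l_{max}$-hole; else if three robots are neighbors of an $l_{max}$-hole, each robot neighbor of only one $l_{max}$-hole moves toward the robot that is neighbor of no $l_{max}$-hole through its shortest neighboring hole; else (two robots are neighbors of the unique $l_{max}$-hole) each neighbor of the unique $l_{max}$-hole moves through its shortest neighboring hole. Phase II: a robot not located at an extremity of the $4$-segment tries to move toward its neighboring node that is not an extremity of the $4$-segment. Phase III: the robot at the arrow tail moves toward the arrow head through the hole having it and the arrow head as neighbors. -}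

module Defs where

open import Data.Nat using (ℕ; zero; suc; _+_; _*_; _∸_; _≤_; _<_; _⊔_; _⊓_; NonZero)
import Data.Nat as N
open import Data.Nat.DivMod using (_mod_; _%_)
open import Data.Fin using (Fin; toℕ)
import Data.Fin as F
open import Data.List using (List; map; foldr; allFin)
open import Data.Nat.ListAction using (sum)
open import Data.Bool using (Bool; true; false; if_then_else_; _∨_)
open import Data.Product using (Σ; ∃; ∃₂; _×_; _,_)
open import Data.Sum using (_⊎_)
open import Relation.Binary.PropositionalEquality using (_≡_; _≢_)
open import Relation.Nullary using (¬_; does)

-- Global (modeller's) orientation of the ring: cw = +1, ccw = -1.
-- Robots do not see it; every rule below is invariant under reversal.

data Dir : Set where
  cw ccw : Dir

opp : Dir → Dir
opp cw = ccw
opp ccw = cw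

-- A configuration: number of robots on each node u_0 … u_{n-1}.
Config : ℕ → Set
Config n = Fin n → ℕ

module _ {n : ℕ} .{{_ : NonZero n}} where

  step : Dir → Fin n → Fin n
  step cw  u = suc (toℕ u) mod n
  step ccw u = (toℕ u + (n ∸ 1)) mod n

  walk : Dir → Fin n → ℕ → Fin n
  walk d u zero    = u
  walk d u (suc k) = step d (walk d u k)

  dist : Fin n → Fin n → ℕ
  dist u v = ((toℕ v + n) ∸ toℕ u) % n ⊓ ((toℕ u + n) ∸ toℕ v) % n

  Free : Config n → Fin n → Set
  Free c u = c u ≡ 0

  Occ : Config n → Fin n → Set
  Occ c u = 1 ≤ c u

  Towerless : Config n → Set
  Towerless c = ∀ u → c u ≤ 1

  -- Seg c s ℓ : the ℓ nodes s, s+1, …, s+ℓ-1 form a segment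
  -- (maximal path of occupied nodes), listed from its cw-first node s.
  Seg : Config n → Fin n → ℕ → Set
  Seg c s ℓ = 1 ≤ ℓ × ℓ < n
            × (∀ j → j < ℓ → Occ c (walk cw s j))
            × Free c (walk ccw s 1) × Free c (walk cw s ℓ)

  HasSeg : Config n → ℕ → Set
  HasSeg c x = ∃ λ s → Seg c s x

  Isolated : Config n → Fin n → Set
  Isolated c u = Seg c u 1

  Unique2 : Config n → Set
  Unique2 c = ∃ λ s → Seg c s 2 × (∀ s' → Seg c s' 2 → s' ≡ s)

  Two2 : Config n → Set
  Two2 c = ∃₂ λ s s' → s ≢ s' × Seg c s 2 × Seg c s' 2
                     × (∀ s'' → Seg c s'' 2 → s'' ≡ s ⊎ s'' ≡ s')

  freeRun : Config n → Dir → Fin n → ℕ → ℕ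
  freeRun c d v zero = 0
  freeRun c d v (suc f) with c v
  ... | zero  = suc (freeRun c d (step d v) f)
  ... | suc _ = 0

  -- for an occupied node u: the length of the hole neighbouring u on
  -- side d (0 if the neighbouring node on side d is occupied)
  gap : Config n → Dir → Fin n → ℕ
  gap c d u = freeRun c d (step d u) (n ∸ 1)

  -- the other neighbour of the hole on side d of u
  holeEnd : Config n → Dir → Fin n → Fin n
  holeEnd c d u = walk d u (suc (gap c d u))

  lmax : Config n → ℕ
  lmax c = foldr _⊔_ 0
    (map (λ u → if does (c u N.≟ 0) then 0 else gap c cw u ⊔ gap c ccw u)
         (allFin n))

  nbL? : Config n → Fin n → Bool
  nbL? c u = does (gap c cw u N.≟ lmax c) ∨ does (gap c ccw u N.≟ lmax c)

  NbL : Config n → Fin n → Set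
  NbL c u = nbL? c u ≡ true

  NbL2 : Config n → Fin n → Set
  NbL2 c u = gap c cw u ≡ lmax c × gap c ccw u ≡ lmax c

  nbLCount : Config n → ℕ
  nbLCount c = sum (map (λ u → if nbL? c u then c u else 0) (allFin n))

  dSeg2 : Fin n → Fin n → ℕ
  dSeg2 s u = dist u s ⊓ dist u (step cw s)

  Arrow : Config n → Dir → Fin n → ℕ → Set
  Arrow c d t k = 1 ≤ k × k + 3 ≤ n × c t ≡ 1
                × (∀ j → 1 ≤ j → j ≤ k → Free c (walk d t j))
                × c (walk d t (suc k)) ≡ 2
                × c (walk d t (suc (suc k))) ≡ 1

  arrowHead : Dir → Fin n → ℕ → Fin n
  arrowHead d t k = walk d t (suc (suc k))

  HasArrow : Config n → Set
  HasArrow c = ∃ λ d → ∃ λ t → ∃ λ k → Arrow c d t k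

  FinalArrow : Config n → Set
  FinalArrow c = ∃ λ d → ∃ λ t → Arrow c d t (n ∸ 4)

  Has4 : Config n → Set
  Has4 c = HasSeg c 4

  PhaseI PhaseII PhaseIII : Config n → Set
  PhaseI c   = ¬ FinalArrow c × ¬ HasArrow c × ¬ Has4 c
  PhaseII c  = ¬ FinalArrow c × Has4 c
  PhaseIII c = ¬ FinalArrow c × ¬ Has4 c × HasArrow c

  CaseA CaseB CaseC CaseD AllNbL CaseD1 CaseD2 CaseD3 : Config n → Set
  CaseA c = HasSeg c 3
  CaseB c = ¬ HasSeg c 3 × Unique2 c
  CaseC c = ¬ HasSeg c 3 × ¬ Unique2 c × Two2 c
  CaseD c = ¬ HasSeg c 3 × ¬ Unique2 c × ¬ Two2 c
  AllNbL c = ∀ u → Occ c u → NbL c u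
  CaseD1 c = CaseD c × AllNbL c
  CaseD2 c = CaseD c × ¬ AllNbL c × nbLCount c ≡ 3
  CaseD3 c = CaseD c × ¬ AllNbL c × ¬ nbLCount c ≡ 3

  -- Mv c u d : a robot on u is instructed to move (deterministically)
  -- to its neighbour in direction d.
  Mv : Config n → Fin n → Dir → Set
  Mv c u d =
      (PhaseI c × CaseA c × Isolated c u × gap c d u ≤ gap c (opp d) u)
    ⊎
      (PhaseI c × CaseB c × Isolated c u
        × (∃ λ s → Seg c s 2
            × (∀ u' → Isolated c u' → dSeg2 s u ≤ dSeg2 s u')
            × 1 ≤ gap c d u
            × (holeEnd c d u ≡ s ⊎ holeEnd c d u ≡ step cw s)))
    ⊎
      (PhaseI c × CaseD2 c × Occ c u × NbL c u × ¬ NbL2 c u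
        × gap c d u ≤ gap c (opp d) u)
    ⊎
      (PhaseI c × CaseD3 c × Occ c u × NbL c u
        × gap c d u ≤ gap c (opp d) u)
    ⊎
      (PhaseIII c × (∃ λ d' → ∃ λ k → Arrow c d' u k
        × 1 ≤ gap c d u × holeEnd c d u ≡ arrowHead d' u k))

  -- Try c u d : a robot on u is instructed to try to move (fair coin)
  -- to its neighbour in direction d.
  Try : Config n → Fin n → Dir → Set
  Try c u d =
      (PhaseI c × CaseC c × Occ c u × 1 ≤ gap c d u × gap c d u ≡ lmax c)
    ⊎
      (PhaseI c × CaseD1 c × Occ c u × 1 ≤ gap c d u × gap c d u ≡ lmax c)
    ⊎
      (PhaseII c × Occ c u
        × (∃ λ s → Seg c s 4 × u ≢ s × u ≢ walk cw s 3
                  × step d u ≢ s × step d u ≢ walk cw s 3))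

  -- Allowed c u v : an activated robot on u may end its cycle on v
  -- (for some coin outcome / adversarial choice of edge).
  Allowed : Config n → Fin n → Fin n → Set
  Allowed c u v =
      (v ≡ u × ¬ (∃ λ d → Mv c u d))
    ⊎ (∃ λ d → (Mv c u d ⊎ Try c u d) × v ≡ step d u)

  Pos : Set
  Pos = Fin 4 → Fin n

  cfg : Pos → Config n
  cfg p u = sum (map (λ i → if does (p i F.≟ u) then 1 else 0) (allFin 4))

  -- one instant: a nonempty set S of robots performs a full
  -- Look-Compute-Move cycle on the same snapshot; the others stay.
  Step : Pos → Pos → Set
  Step p p' = Σ (Fin 4 → Bool) λ S → (∃ λ i → S i ≡ true)
    × (∀ i → (S i ≡ true → Allowed (cfg p) (p i) (p' i))
           × (S i ≡ false → p' i ≡ p i))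

-- A tower can only appear at instant t + 1 if two robots end their cycles on the same node.
-- Without a 4-segment Phase II is not selected, and without a tower there is no arrow, so
-- Phase III is not selected either; in Phase I every instructed robot moves onto a free node.
-- Hence the only danger is two robots at distance two moving onto the free node between them,
-- and each Phase I rule excludes this: a hole of length 1 is never a longest hole (four robots
-- on more than eight nodes leave a hole of length at least 2); two isolated robots next to a
-- 3-segment would be five occupied nodes; a robot moving toward the unique 2-segment through a
-- hole of length 1 faces an extremity of that segment, which is not isolated; and in the last
-- two sub-cases of I(d) both robots would border l_max-holes on their outer sides, whose far
-- ends are then the other two robots, so that all four robots border an l_max-hole.

module Submission where

open import Defs
open import Data.Nat using (ℕ; _<_; NonZero)
open import Relation.Nullary using (¬_)

open import Data.Nat hiding (_<_; NonZero)
open import Data.Nat.Properties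
open import Data.Nat.DivMod
open import Data.Nat.ListAction using (sum)
open import Data.Fin using (Fin; toℕ)
import Data.Fin as F
import Data.Fin.Properties as Finₚ
open import Data.Bool using (true; false; if_then_else_; _∨_)
open import Data.Bool.Properties using (∨-zeroʳ)
open import Data.Empty using (⊥)
open import Data.Product using (∃; ∃₂; _×_; _,_; proj₁; proj₂)
open import Data.Sum using (_⊎_; inj₁; inj₂; [_,_])
import Data.Sum as Sum
open import Data.List using (List; []; _∷_; _∷ʳ_; map; foldr; allFin; length; lookup; upTo)
open import Data.List.Properties using (length-map)
open import Data.List.Membership.Propositional using (_∈_)
open import Data.List.Membership.Propositional.Properties using (∈-allFin; ∈-lookup)
open import Data.List.Relation.Unary.Any using (here; there)
open import Data.List.Relation.Unary.All as All using (All; []; _∷_)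
import Data.List.Relation.Unary.All.Properties as All
open import Data.List.Relation.Unary.AllPairs using (AllPairs; []; _∷_)
open import Data.List.Relation.Unary.Linked using (Linked; []; [-]; _∷_)
open import Data.List.Relation.Unary.Linked.Properties using (Linked⇒AllPairs)
open import Data.List.Relation.Unary.Unique.Propositional using (Unique)
open import Data.List.Relation.Unary.Unique.Propositional.Properties using (allFin⁺)
open import Function.Base using (_∘_; id)
open import Function.Definitions using (Injective)
open import Relation.Nullary using (Dec; yes; no; contradiction)
open import Relation.Nullary.Decidable using (does; dec-true; dec-false; ¬?; _×-dec_)
open import Relation.Binary.PropositionalEquality hiding ([_])
open import Algebra.Properties.CommutativeSemigroup +-commutativeSemigroup using (x∙yz≈y∙xz)

∈⇒≤foldr-⊔ : ∀ {A : Set} (f : A → ℕ) {xs : List A} {x} → x ∈ xs → f x ≤ foldr _⊔_ 0 (map f xs)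
∈⇒≤foldr-⊔ f (here refl) = m≤m⊔n _ _
∈⇒≤foldr-⊔ f {y ∷ _} (there x∈xs) = ≤-trans (∈⇒≤foldr-⊔ f x∈xs) (m≤n⊔m (f y) _)

∈⇒≤sum : ∀ {A : Set} (f : A → ℕ) {xs : List A} {x} → x ∈ xs → f x ≤ sum (map f xs)
∈⇒≤sum f (here refl)         = m≤m+n _ _
∈⇒≤sum f {y ∷ _} (there x∈xs) = ≤-trans (∈⇒≤sum f x∈xs) (m≤n+m _ (f y))

≢∈⇒+≤sum : ∀ {A : Set} (f : A → ℕ) {xs : List A} {x y} → x ∈ xs → y ∈ xs → x ≢ y →
           f x + f y ≤ sum (map f xs)
≢∈⇒+≤sum f (here refl)  (here refl)  x≢y = contradiction refl x≢y
≢∈⇒+≤sum f (here refl)  (there y∈xs) _   = +-monoʳ-≤ _ (∈⇒≤sum f y∈xs)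
≢∈⇒+≤sum f {_ ∷ xs} {x} {y} (there x∈xs) (here refl) _ =
  ≤-trans (≤-reflexive (+-comm (f x) (f y))) (+-monoʳ-≤ (f y) (∈⇒≤sum f x∈xs))
≢∈⇒+≤sum f {z ∷ _} (there x∈xs) (there y∈xs) x≢y =
  ≤-trans (≢∈⇒+≤sum f x∈xs y∈xs x≢y) (m≤n+m _ (f z))

sum-map-0 : ∀ {A : Set} (f : A → ℕ) {xs : List A} → All (λ x → f x ≡ 0) xs → sum (map f xs) ≡ 0
sum-map-0 f []           = refl
sum-map-0 f (fx≡0 ∷ all) = cong₂ _+_ fx≡0 (sum-map-0 f all)

Unique⇒lookup-injective : ∀ {A : Set} {xs : List A} → Unique xs → Injective _≡_ _≡_ (lookup xs)
Unique⇒lookup-injective (x∉xs ∷ _) {F.zero}  {F.zero}  _ = refl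
Unique⇒lookup-injective (x∉xs ∷ _) {F.zero}  {F.suc j} e = contradiction e (All.lookup x∉xs (∈-lookup j))
Unique⇒lookup-injective (x∉xs ∷ _) {F.suc i} {F.zero}  e = contradiction (sym e) (All.lookup x∉xs (∈-lookup i))
Unique⇒lookup-injective (_ ∷ uniq) {F.suc i} {F.suc j} e = cong F.suc (Unique⇒lookup-injective uniq e)

-- Walking around the ring

module _ {n : ℕ} .{{_ : NonZero n}} where

  private
    toℕ-mod : ∀ m → toℕ (m mod n) ≡ m % n
    toℕ-mod m = Finₚ.toℕ-fromℕ< (m%n<n m n)

    [m%n+k]%n≡[m+k]%n : ∀ m k → (m % n + k) % n ≡ (m + k) % n
    [m%n+k]%n≡[m+k]%n m k = begin
      (m % n + k) % n           ≡⟨ %-distribˡ-+ (m % n) k n ⟩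
      (m % n % n + k % n) % n   ≡⟨ cong (λ x → (x + k % n) % n) (m%n%n≡m%n m n) ⟩
      (m % n + k % n) % n       ≡⟨ %-distribˡ-+ m k n ⟨
      (m + k) % n               ∎
      where open ≡-Reasoning

    [k+m%n]%n≡[k+m]%n : ∀ k m → (k + m % n) % n ≡ (k + m) % n
    [k+m%n]%n≡[k+m]%n k m = begin
      (k + m % n) % n  ≡⟨ cong (_% n) (+-comm k (m % n)) ⟩
      (m % n + k) % n  ≡⟨ [m%n+k]%n≡[m+k]%n m k ⟩
      (m + k) % n      ≡⟨ cong (_% n) (+-comm m k) ⟩
      (k + m) % n      ∎
      where open ≡-Reasoning

    [1+m+[n∸1]]%n≡m : ∀ m → m < n → (suc m + (n ∸ 1)) % n ≡ m
    [1+m+[n∸1]]%n≡m m m<n = begin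
      (suc m + (n ∸ 1)) % n  ≡⟨ cong (_% n) (+-suc m (n ∸ 1)) ⟨
      (m + suc (n ∸ 1)) % n  ≡⟨ cong (λ x → (m + x) % n) (m+[n∸m]≡n (>-nonZero⁻¹ n)) ⟩
      (m + n) % n            ≡⟨ [m+n]%n≡m%n m n ⟩
      m % n                  ≡⟨ m<n⇒m%n≡m m<n ⟩
      m                      ∎
      where open ≡-Reasoning

  toℕ-walk-cw : ∀ (u : Fin n) k → toℕ (walk cw u k) ≡ (toℕ u + k) % n
  toℕ-walk-cw u zero = sym (trans (cong (_% n) (+-identityʳ (toℕ u))) (m<n⇒m%n≡m (Finₚ.toℕ<n u)))
  toℕ-walk-cw u (suc k) = begin
    toℕ (walk cw u (suc k))      ≡⟨ toℕ-mod (suc (toℕ (walk cw u k))) ⟩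
    suc (toℕ (walk cw u k)) % n  ≡⟨ cong (λ x → suc x % n) (toℕ-walk-cw u k) ⟩
    (1 + (toℕ u + k) % n) % n    ≡⟨ [k+m%n]%n≡[k+m]%n 1 (toℕ u + k) ⟩
    suc (toℕ u + k) % n          ≡⟨ cong (_% n) (+-suc (toℕ u) k) ⟨
    (toℕ u + suc k) % n          ∎
    where open ≡-Reasoning

  step-opp-step : ∀ d (u : Fin n) → step (opp d) (step d u) ≡ u
  step-opp-step cw u = Finₚ.toℕ-injective (begin
    toℕ (step ccw (step cw u))       ≡⟨ toℕ-mod (toℕ (step cw u) + (n ∸ 1)) ⟩
    (toℕ (step cw u) + (n ∸ 1)) % n  ≡⟨ cong (λ x → (x + (n ∸ 1)) % n) (toℕ-mod (suc (toℕ u))) ⟩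
    (suc (toℕ u) % n + (n ∸ 1)) % n  ≡⟨ [m%n+k]%n≡[m+k]%n (suc (toℕ u)) (n ∸ 1) ⟩
    (suc (toℕ u) + (n ∸ 1)) % n      ≡⟨ [1+m+[n∸1]]%n≡m (toℕ u) (Finₚ.toℕ<n u) ⟩
    toℕ u                            ∎)
    where open ≡-Reasoning
  step-opp-step ccw u = Finₚ.toℕ-injective (begin
    toℕ (step cw (step ccw u))       ≡⟨ toℕ-mod (suc (toℕ (step ccw u))) ⟩
    suc (toℕ (step ccw u)) % n       ≡⟨ cong (λ x → suc x % n) (toℕ-mod (toℕ u + (n ∸ 1))) ⟩
    (1 + (toℕ u + (n ∸ 1)) % n) % n  ≡⟨ [k+m%n]%n≡[k+m]%n 1 (toℕ u + (n ∸ 1)) ⟩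
    (suc (toℕ u) + (n ∸ 1)) % n      ≡⟨ [1+m+[n∸1]]%n≡m (toℕ u) (Finₚ.toℕ<n u) ⟩
    toℕ u                            ∎)
    where open ≡-Reasoning

  step-step-opp : ∀ d (u : Fin n) → step d (step (opp d) u) ≡ u
  step-step-opp cw  = step-opp-step ccw
  step-step-opp ccw = step-opp-step cw

  step-injective : ∀ d {u v : Fin n} → step d u ≡ step d v → u ≡ v
  step-injective d {u} {v} e = begin
    u                         ≡⟨ step-opp-step d u ⟨
    step (opp d) (step d u)   ≡⟨ cong (step (opp d)) e ⟩
    step (opp d) (step d v)   ≡⟨ step-opp-step d v ⟩
    v                         ∎
    where open ≡-Reasoning

  opposite-steps-meet : ∀ d {u v : Fin n} → step d u ≡ step (opp d) v → v ≡ walk d u 2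
  opposite-steps-meet d {u} {v} e = trans (sym (step-step-opp d v)) (cong (step d) (sym e))

  walk-+ : ∀ d (u : Fin n) a b → walk d u (a + b) ≡ walk d (walk d u a) b
  walk-+ d u a zero    = cong (walk d u) (+-identityʳ a)
  walk-+ d u a (suc b) = trans (cong (walk d u) (+-suc a b)) (cong (step d) (walk-+ d u a b))

  walk-suc : ∀ d (u : Fin n) k → walk d u (suc k) ≡ walk d (step d u) k
  walk-suc d u = walk-+ d u 1

  walk-opp-walk : ∀ d (u : Fin n) k → walk (opp d) (walk d u k) k ≡ u
  walk-opp-walk d u zero    = refl
  walk-opp-walk d u (suc k) = begin
    walk (opp d) (walk d u (suc k)) (suc k)              ≡⟨ walk-suc (opp d) _ k ⟩
    walk (opp d) (step (opp d) (step d (walk d u k))) k  ≡⟨ cong (λ x → walk (opp d) x k) (step-opp-step d _) ⟩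
    walk (opp d) (walk d u k) k                          ≡⟨ walk-opp-walk d u k ⟩
    u                                                    ∎
    where open ≡-Reasoning

  walk-opp-walk-∸ : ∀ d (u : Fin n) {m} j → j ≤ m → walk (opp d) (walk d u m) j ≡ walk d u (m ∸ j)
  walk-opp-walk-∸ d u {m} j j≤m = begin
    walk (opp d) (walk d u m) j                  ≡⟨ cong (λ x → walk (opp d) (walk d u x) j) (m∸n+n≡m j≤m) ⟨
    walk (opp d) (walk d u (m ∸ j + j)) j        ≡⟨ cong (λ x → walk (opp d) x j) (walk-+ d u (m ∸ j) j) ⟩
    walk (opp d) (walk d (walk d u (m ∸ j)) j) j ≡⟨ walk-opp-walk d _ j ⟩
    walk d u (m ∸ j)                             ∎
    where open ≡-Reasoning

  walk-n : ∀ d (u : Fin n) → walk d u n ≡ u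
  walk-n cw  u = Finₚ.toℕ-injective (trans (toℕ-walk-cw u n)
                   (trans ([m+n]%n≡m%n (toℕ u) n) (m<n⇒m%n≡m (Finₚ.toℕ<n u))))
  walk-n ccw u = trans (cong (λ x → walk ccw x n) (sym (walk-n cw u))) (walk-opp-walk cw u n)

  walk-opp≡walk-∸ : ∀ d (u : Fin n) m → m ≤ n → walk (opp d) u m ≡ walk d u (n ∸ m)
  walk-opp≡walk-∸ d u m m≤n = trans (cong (λ x → walk (opp d) x m) (sym (walk-n d u)))
                                    (walk-opp-walk-∸ d u m m≤n)

  private
    walk-cw-moves : ∀ (x : Fin n) k → 0 < k → k < n → walk cw x k ≢ x
    walk-cw-moves x k 0<k k<n e with toℕ x + k <? n
    ... | yes x+k<n = >⇒≢ 0<k (+-cancelˡ-≡ (toℕ x) k 0 (begin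
          toℕ x + k        ≡⟨ m<n⇒m%n≡m x+k<n ⟨
          (toℕ x + k) % n  ≡⟨ [x+k]%n≡x ⟩
          toℕ x            ≡⟨ +-identityʳ (toℕ x) ⟨
          toℕ x + 0        ∎))
      where
        open ≡-Reasoning
        [x+k]%n≡x = trans (sym (toℕ-walk-cw x k)) (cong toℕ e)
    ... | no x+k≮n = <⇒≢ k<n (+-cancelˡ-≡ (toℕ x) k n
          (∸-cancelʳ-≡ n≤x+k (m≤n+m n (toℕ x)) (begin
            toℕ x + k ∸ n        ≡⟨ m<n⇒m%n≡m (m<n+o⇒m∸n<o (toℕ x + k) n (+-mono-< (Finₚ.toℕ<n x) k<n)) ⟨
            (toℕ x + k ∸ n) % n  ≡⟨ m≤n⇒[n∸m]%m≡n%m n≤x+k ⟩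
            (toℕ x + k) % n      ≡⟨ [x+k]%n≡x ⟩
            toℕ x                ≡⟨ m+n∸n≡m (toℕ x) n ⟨
            toℕ x + n ∸ n        ∎)))
      where
        open ≡-Reasoning
        n≤x+k = ≮⇒≥ x+k≮n
        [x+k]%n≡x = trans (sym (toℕ-walk-cw x k)) (cong toℕ e)

    walk-moves : ∀ d (x : Fin n) k → 0 < k → k < n → walk d x k ≢ x
    walk-moves cw  x k 0<k k<n e = walk-cw-moves x k 0<k k<n e
    walk-moves ccw x k 0<k k<n e =
      walk-cw-moves x k 0<k k<n (trans (cong (λ y → walk cw y k) (sym e)) (walk-opp-walk ccw x k))

  walk-injective : ∀ d (u : Fin n) {a b} → a < b → b < n → walk d u a ≢ walk d u b
  walk-injective d u {a} {b} a<b b<n e =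
    walk-moves d (walk d u a) (b ∸ a) (m<n⇒0<n∸m a<b) (≤-<-trans (m∸n≤m b a) b<n) (begin
      walk d (walk d u a) (b ∸ a)  ≡⟨ walk-+ d u a (b ∸ a) ⟨
      walk d u (a + (b ∸ a))       ≡⟨ cong (walk d u) (m+[n∸m]≡n (<⇒≤ a<b)) ⟩
      walk d u b                   ≡⟨ e ⟨
      walk d u a                   ∎)
    where open ≡-Reasoning

  walk-surjective : ∀ d (u z : Fin n) → ∃ λ k → k < n × walk d u k ≡ z
  walk-surjective cw u z = k , m%n<n _ n , Finₚ.toℕ-injective (begin
      toℕ (walk cw u k)                       ≡⟨ toℕ-walk-cw u k ⟩
      (toℕ u + (toℕ z + (n ∸ toℕ u)) % n) % n ≡⟨ [k+m%n]%n≡[k+m]%n (toℕ u) _ ⟩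
      (toℕ u + (toℕ z + (n ∸ toℕ u))) % n     ≡⟨ cong (_% n) (x∙yz≈y∙xz (toℕ u) (toℕ z) _) ⟩
      (toℕ z + (toℕ u + (n ∸ toℕ u))) % n     ≡⟨ cong (λ y → (toℕ z + y) % n) (m+[n∸m]≡n (<⇒≤ (Finₚ.toℕ<n u))) ⟩
      (toℕ z + n) % n                         ≡⟨ [m+n]%n≡m%n (toℕ z) n ⟩
      toℕ z % n                               ≡⟨ m<n⇒m%n≡m (Finₚ.toℕ<n z) ⟩
      toℕ z                                   ∎)
    where
      open ≡-Reasoning
      k = (toℕ z + (n ∸ toℕ u)) % n
  walk-surjective ccw u z with walk-surjective cw z u
  ... | k , k<n , e = k , k<n , trans (cong (λ y → walk ccw y k) (sym e)) (walk-opp-walk cw z k)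

  walk-unique : ∀ d (u : Fin n) {ks} → AllPairs _<_ (ks ∷ʳ n) → Unique (map (walk d u) ks)
  walk-unique d u {[]}     _                  = []
  walk-unique d u {k ∷ ks} (k<later ∷ ordered) =
    All.map⁺ (All.zipWith (λ (k<j , j<n) → walk-injective d u k<j j<n) (proj₁ (All.∷ʳ⁻ k<later) , below-n ordered))
    ∷ walk-unique d u ordered
    where
      below-n : ∀ {ks} → AllPairs _<_ (ks ∷ʳ n) → All (_< n) ks
      below-n {[]}    _                 = []
      below-n {_ ∷ _} (j<later ∷ ordered) = proj₂ (All.∷ʳ⁻ j<later) ∷ below-n ordered

  <⇒≤n∸1 : ∀ {k} → k < n → k ≤ n ∸ 1
  <⇒≤n∸1 {k} k<n = subst (k ≤_) (pred[m∸n]≡m∸[1+n] n 0) (<⇒≤pred k<n)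

-- Holes and segments

module _ {n : ℕ} .{{_ : NonZero n}} (c : Config n) where

  Free⇒¬Occ : ∀ {u} → Free c u → ¬ Occ c u
  Free⇒¬Occ free occ with () ← subst (1 ≤_) free occ

  ¬Occ⇒Free : ∀ {u} → ¬ Occ c u → Free c u
  ¬Occ⇒Free {u} ¬occ with c u
  ... | zero  = refl
  ... | suc _ = contradiction (s≤s z≤n) ¬occ

  freeRun-free : ∀ d v f {j} → j < freeRun c d v f → Free c (walk d v j)
  freeRun-free d v (suc f) {j} j<run with c v in eq
  freeRun-free d v (suc f) {zero}  _           | zero = eq
  freeRun-free d v (suc f) {suc j} (s≤s j<run) | zero =
    subst (Free c) (sym (walk-suc d v j)) (freeRun-free d (step d v) f j<run)

  freeRun-blocked : ∀ d v f → freeRun c d v f < f → Occ c (walk d v (freeRun c d v f))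
  freeRun-blocked d v (suc f) run<f with c v in eq
  ... | zero  = subst (Occ c) (sym (walk-suc d v (freeRun c d (step d v) f))) (freeRun-blocked d (step d v) f (s<s⁻¹ run<f))
  ... | suc _ = subst (1 ≤_) (sym eq) (s≤s z≤n)

  freeRun-≥ : ∀ d v {m} f → (∀ j → j < m → Free c (walk d v j)) → m ≤ f → m ≤ freeRun c d v f
  freeRun-≥ d v {zero}  f       _    _         = z≤n
  freeRun-≥ d v {suc m} (suc f) free (s≤s m≤f) with c v | free 0 z<s
  ... | zero | _ = s≤s (freeRun-≥ d (step d v) f
                     (λ j j<m → subst (Free c) (walk-suc d v j) (free (suc j) (s<s j<m))) m≤f)

  freeRun≤fuel : ∀ d v f → freeRun c d v f ≤ f
  freeRun≤fuel d v zero = z≤n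
  freeRun≤fuel d v (suc f) with c v
  ... | zero  = s≤s (freeRun≤fuel d (step d v) f)
  ... | suc _ = z≤n

  gap-free : ∀ d u {j} → 1 ≤ j → j ≤ gap c d u → Free c (walk d u j)
  gap-free d u {suc j} _ j<gap =
    subst (Free c) (sym (walk-suc d u j)) (freeRun-free d (step d u) (n ∸ 1) j<gap)

  gap-blocked : ∀ d u → gap c d u < n ∸ 1 → Occ c (walk d u (suc (gap c d u)))
  gap-blocked d u gap<n∸1 =
    subst (Occ c) (sym (walk-suc d u (gap c d u))) (freeRun-blocked d (step d u) (n ∸ 1) gap<n∸1)

  gap-≥ : ∀ d u {m} → (∀ j → 1 ≤ j → j ≤ m → Free c (walk d u j)) → m ≤ n ∸ 1 → m ≤ gap c d u
  gap-≥ d u free m≤n∸1 = freeRun-≥ d (step d u) (n ∸ 1)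
    (λ j j<m → subst (Free c) (walk-suc d u j) (free (suc j) (s≤s z≤n) j<m)) m≤n∸1

  gap≤n∸1 : ∀ d u → gap c d u ≤ n ∸ 1
  gap≤n∸1 d u = freeRun≤fuel d (step d u) (n ∸ 1)

  gap-exact : ∀ d u {L} → (∀ j → 1 ≤ j → j ≤ L → Free c (walk d u j)) →
              Occ c (walk d u (suc L)) → L ≤ n ∸ 1 → gap c d u ≡ L
  gap-exact d u {L} free occ L≤n∸1 = ≤-antisym
    (≮⇒≥ λ L<gap → Free⇒¬Occ (gap-free d u (s≤s z≤n) L<gap) occ)
    (gap-≥ d u free L≤n∸1)

  gap≡1 : ∀ d u → Free c (step d u) → Occ c (walk d u 2) → 1 < n → gap c d u ≡ 1
  gap≡1 d u free occ 1<n = gap-exact d u (λ { (suc zero) _ _ → free ; (suc (suc _)) _ (s≤s ()) }) occ (<⇒≤n∸1 1<n)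

  gap<n∸1 : ∀ d u {v} → v ≢ u → Occ c v → gap c d u < n ∸ 1
  gap<n∸1 d u {v} v≢u occ with walk-surjective d u v
  ... | zero  , _   , refl = contradiction refl v≢u
  ... | suc k , k<n , refl = ≤∧≢⇒< (gap≤n∸1 d u) λ gap≡n∸1 →
        Free⇒¬Occ (gap-free d u (s≤s z≤n) (subst (suc k ≤_) (sym gap≡n∸1) (<⇒≤n∸1 k<n))) occ

  gap-holeEnd : ∀ d u → Occ c u → gap c d u < n ∸ 1 → gap c (opp d) (holeEnd c d u) ≡ gap c d u
  gap-holeEnd d u occ gap<n∸1 = gap-exact (opp d) (holeEnd c d u) free-back
    (subst (Occ c) (sym (walk-opp-walk d u (suc L))) occ) (<⇒≤ gap<n∸1)
    where
      L = gap c d u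
      free-back : ∀ j → 1 ≤ j → j ≤ L → Free c (walk (opp d) (holeEnd c d u) j)
      free-back j 1≤j j≤L = subst (Free c) (sym (walk-opp-walk-∸ d u j (m≤n⇒m≤1+n j≤L)))
        (gap-free d u (m<n⇒0<n∸m (s≤s j≤L)) (∸-monoʳ-≤ (suc L) 1≤j))

  gap≤lmax : ∀ d u → Occ c u → gap c d u ≤ lmax c
  gap≤lmax d u occ = ≤-trans (gap≤hole-sizes d) (∈⇒≤foldr-⊔ _ (∈-allFin u))
    where
      gap≤hole-sizes : ∀ d → gap c d u ≤ (if does (c u ≟ 0) then 0 else gap c cw u ⊔ gap c ccw u)
      gap≤hole-sizes d with c u
      gap≤hole-sizes d   | zero  = contradiction occ λ ()
      gap≤hole-sizes cw  | suc _ = m≤m⊔n _ _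
      gap≤hole-sizes ccw | suc _ = m≤n⊔m _ _

  gap≡lmax⇒NbL : ∀ d u → gap c d u ≡ lmax c → NbL c u
  gap≡lmax⇒NbL cw  u e = cong (_∨ does (gap c ccw u ≟ lmax c)) (dec-true (gap c cw u ≟ lmax c) e)
  gap≡lmax⇒NbL ccw u e =
    trans (cong (does (gap c cw u ≟ lmax c) ∨_) (dec-true (gap c ccw u ≟ lmax c) e)) (∨-zeroʳ _)

  NbL⇒gap≡lmax : ∀ d u → NbL c u → gap c d u ≡ lmax c ⊎ gap c (opp d) u ≡ lmax c
  NbL⇒gap≡lmax cw  u nbl with gap c cw u ≟ lmax c | gap c ccw u ≟ lmax c
  ... | yes e  | _      = inj₁ e
  ... | no _   | yes e  = inj₂ e
  ... | no ¬e₁ | no ¬e₂ = contradiction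
    (trans (sym nbl) (cong₂ _∨_ (dec-false (gap c cw u ≟ lmax c) ¬e₁) (dec-false (gap c ccw u ≟ lmax c) ¬e₂)))
    λ ()
  NbL⇒gap≡lmax ccw u nbl = Sum.swap (NbL⇒gap≡lmax cw u nbl)

  OccupiedRun : Fin n → ℕ → Set
  OccupiedRun b ℓ = ∀ j → j < ℓ → Occ c (walk cw b j)

  OccupiedRun-extendʳ : ∀ {b ℓ} → OccupiedRun b ℓ → Occ c (walk cw b ℓ) → OccupiedRun b (suc ℓ)
  OccupiedRun-extendʳ run occ j j<1+ℓ with m<1+n⇒m<n∨m≡n j<1+ℓ
  ... | inj₁ j<ℓ  = run j j<ℓ
  ... | inj₂ refl = occ

  OccupiedRun-extendˡ : ∀ {b ℓ} → OccupiedRun b ℓ → Occ c (step ccw b) → OccupiedRun (step ccw b) (suc ℓ)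
  OccupiedRun-extendˡ     run occ zero    _       = occ
  OccupiedRun-extendˡ {b} run occ (suc j) j<1+ℓ = subst (Occ c)
    (sym (trans (walk-suc cw (step ccw b) j) (cong (λ x → walk cw x j) (step-step-opp cw b))))
    (run j (s<s⁻¹ j<1+ℓ))

  Seg-occupied : ∀ {s ℓ} → Seg c s ℓ → OccupiedRun s ℓ
  Seg-occupied (_ , _ , run , _) = run

  single : ∀ {u} → Occ c u → OccupiedRun u 1
  single occ zero    _         = occ
  single occ (suc _) (s≤s ())

  Isolated-occupied : ∀ {u} → Isolated c u → Occ c u
  Isolated-occupied iso = Seg-occupied iso 0 z<s

  Isolated-free : ∀ {u} → Isolated c u → ∀ d → Free c (step d u)
  Isolated-free (_ , _ , _ , _ , freeʳ) cw  = freeʳ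
  Isolated-free (_ , _ , _ , freeˡ , _) ccw = freeˡ

  Isolated∉Seg : ∀ {u s ℓ k} → Isolated c u → Seg c s ℓ → 2 ≤ ℓ → k < ℓ → u ≢ walk cw s k
  Isolated∉Seg {s = s} {ℓ} {k} iso seg 2≤ℓ k<ℓ refl with suc k <? ℓ
  ... | yes 1+k<ℓ = Free⇒¬Occ (Isolated-free iso cw) (Seg-occupied seg (suc k) 1+k<ℓ)
  ... | no  1+k≮ℓ = Free⇒¬Occ (Isolated-free iso ccw) (predecessor-occupied k k<ℓ 1+k≮ℓ)
    where
      predecessor-occupied : ∀ k → k < ℓ → ¬ suc k < ℓ → Occ c (step ccw (walk cw s k))
      predecessor-occupied zero    _   1≮ℓ = contradiction 2≤ℓ 1≮ℓ
      predecessor-occupied (suc k) k<ℓ _   = subst (Occ c) (sym (step-opp-step cw (walk cw s k)))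
        (Seg-occupied seg k (<-trans (n<1+n k) k<ℓ))

  Towerless⇒¬HasArrow : Towerless c → ¬ HasArrow c
  Towerless⇒¬HasArrow tl (_ , _ , _ , _ , _ , _ , _ , tower , _) = 1+n≰n (subst (_≤ 1) tower (tl _))

-- Counting robots

module _ {n : ℕ} .{{_ : NonZero n}} (p : Pos {n}) where

  -- cfg p u unfolds definitionally to sum (map (robotsAt u) (allFin 4)).
  private
    robotsAt : Fin n → Fin 4 → ℕ
    robotsAt u i = if does (p i F.≟ u) then 1 else 0

    robotsAt-≡ : ∀ {u i} → p i ≡ u → robotsAt u i ≡ 1
    robotsAt-≡ {u} {i} e = cong (if_then 1 else 0) (dec-true (p i F.≟ u) e)

    robotsAt-≢ : ∀ {u i} → p i ≢ u → robotsAt u i ≡ 0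
    robotsAt-≢ {u} {i} e = cong (if_then 1 else 0) (dec-false (p i F.≟ u) e)

  robot⇒Occ : ∀ i → Occ (cfg p) (p i)
  robot⇒Occ i = subst (_≤ cfg p (p i)) (robotsAt-≡ refl) (∈⇒≤sum (robotsAt (p i)) (∈-allFin i))

  Occ⇒robot : ∀ {v} → Occ (cfg p) v → ∃ λ i → p i ≡ v
  Occ⇒robot {v} occ with Finₚ.any? (λ i → p i F.≟ v)
  ... | yes robot = robot
  ... | no ¬robot = contradiction
    (subst (1 ≤_) (sum-map-0 (robotsAt v) {allFin 4} (All.tabulate λ {i} _ → robotsAt-≢ λ e → ¬robot (i , e))) occ)
    λ ()

  Towerless⇒Injective : Towerless (cfg p) → Injective _≡_ _≡_ p
  Towerless⇒Injective tl {i} {j} pi≡pj with i F.≟ j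
  ... | yes i≡j = i≡j
  ... | no  i≢j = contradiction (≤-trans two-robots (tl (p i))) (1+n≰n {1})
    where
      two-robots : 2 ≤ cfg p (p i)
      two-robots = subst (_≤ cfg p (p i)) (cong₂ _+_ (robotsAt-≡ refl) (robotsAt-≡ (sym pi≡pj)))
                     (≢∈⇒+≤sum (robotsAt (p i)) (∈-allFin i) (∈-allFin j) i≢j)

  Injective⇒Towerless : Injective _≡_ _≡_ p → Towerless (cfg p)
  Injective⇒Towerless inj u = at-most-one (allFin 4) (allFin⁺ 4)
    where
      at-most-one : ∀ is → Unique is → sum (map (robotsAt u) is) ≤ 1
      at-most-one []       []              = z≤n
      at-most-one (i ∷ is) (i∉is ∷ uniq) with p i F.≟ u
      ... | no _     = at-most-one is uniq
      ... | yes pi≡u = ≤-reflexive (cong suc (sum-map-0 (robotsAt u)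
            (All.map (λ i≢j → robotsAt-≢ λ pj≡u → i≢j (inj (trans pi≡u (sym pj≡u)))) i∉is)))

  distinct-occupied≤4 : ∀ {xs} → Unique xs → All (Occ (cfg p)) xs → length xs ≤ 4
  distinct-occupied≤4 {xs} uniq occ = Finₚ.injective⇒≤ robot-injective
    where
      robot : Fin (length xs) → Fin 4
      robot k = proj₁ (Occ⇒robot (All.lookup occ (∈-lookup k)))

      robot-injective : Injective _≡_ _≡_ robot
      robot-injective {k} {k'} e = Unique⇒lookup-injective uniq (begin
        lookup xs k         ≡⟨ proj₂ (Occ⇒robot (All.lookup occ (∈-lookup k))) ⟨
        p (robot k)         ≡⟨ cong p e ⟩
        p (robot k')        ≡⟨ proj₂ (Occ⇒robot (All.lookup occ (∈-lookup k'))) ⟩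
        lookup xs k'        ∎)
        where open ≡-Reasoning

-- Moves of four robots on more than eight nodes

module _ {n : ℕ} .{{_ : NonZero n}} where

  Instructed : Config n → Fin n → Dir → Set
  Instructed c u d = Mv c u d ⊎ Try c u d

  step-outcome : ∀ {p p' : Pos {n}} → Step p p' → ∀ i →
                 p' i ≡ p i ⊎ ∃ λ d → Instructed (cfg p) (p i) d × p' i ≡ step d (p i)
  step-outcome (active , _ , rule) i with active i in active?
  ... | true  = [ inj₁ ∘ proj₁ , inj₂ ] (proj₁ (rule i) active?)
  ... | false = inj₁ (proj₂ (rule i) active?)


module Configuration {n : ℕ} .{{_ : NonZero n}} (n>8 : 8 < n) (p : Pos {n}) where

  c : Config n
  c = cfg p

  occ? : ∀ u → Dec (Occ c u)
  occ? u = 1 ≤? c u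

  small<n : ∀ {k} → k ≤ 8 → k < n
  small<n k≤8 = ≤-<-trans k≤8 n>8

  occupied-along≤4 : ∀ d u {ks} → Linked _<_ (ks ∷ʳ n) → All (λ k → Occ c (walk d u k)) ks → length ks ≤ 4
  occupied-along≤4 d u {ks} ordered occ = subst (_≤ 4) (length-map (walk d u) ks)
    (distinct-occupied≤4 p (walk-unique d u (Linked⇒AllPairs <-trans ordered)) (All.map⁺ occ))

  ¬OccupiedRun5 : ∀ b → ¬ OccupiedRun c b 5
  ¬OccupiedRun5 b run = 1+n≰n (occupied-along≤4 cw b {upTo 5}
    (≤-refl ∷ ≤-refl ∷ ≤-refl ∷ ≤-refl ∷ small<n (s≤s (s≤s (s≤s (s≤s z≤n)))) ∷ [-])
    (All.applyUpTo⁺₁ id 5 (run _)))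

  -- The fuel k bounds how often the run can still grow, since five consecutive occupied
  -- nodes are impossible.
  private
    extend : ∀ k {b ℓ} → k + ℓ ≡ 4 → 1 ≤ ℓ → OccupiedRun c b ℓ →
             ∃₂ λ s ℓ' → ℓ ≤ ℓ' × ℓ' ≤ 4 × Seg c s ℓ'
    extend-longer : ∀ k {b ℓ} → k + ℓ ≡ 4 → OccupiedRun c b (suc ℓ) →
                    ∃₂ λ s ℓ' → ℓ ≤ ℓ' × ℓ' ≤ 4 × Seg c s ℓ'

    extend k {b} {ℓ} k+ℓ≡4 1≤ℓ run with occ? (step ccw b) | occ? (walk cw b ℓ)
    ... | yes occˡ | _        = extend-longer k k+ℓ≡4 (OccupiedRun-extendˡ c run occˡ)
    ... | no _     | yes occʳ = extend-longer k k+ℓ≡4 (OccupiedRun-extendʳ c run occʳ)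
    ... | no ¬occˡ | no ¬occʳ =
      b , ℓ , ≤-refl , ℓ≤4 , 1≤ℓ , ≤-<-trans ℓ≤4 (small<n (s≤s (s≤s (s≤s (s≤s z≤n))))) , run ,
      ¬Occ⇒Free c ¬occˡ , ¬Occ⇒Free c ¬occʳ
      where
        ℓ≤4 : ℓ ≤ 4
        ℓ≤4 = subst (ℓ ≤_) k+ℓ≡4 (m≤n+m ℓ k)

    extend-longer zero    refl  run = contradiction run (¬OccupiedRun5 _)
    extend-longer (suc k) {ℓ = ℓ} k+ℓ≡4 run with extend k (trans (+-suc k ℓ) k+ℓ≡4) (s≤s z≤n) run
    ... | s , ℓ' , ℓ<ℓ' , ℓ'≤4 , seg = s , ℓ' , <⇒≤ ℓ<ℓ' , ℓ'≤4 , seg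

  adjacent-occupied⇒Seg : ∀ d {u} → Occ c u → Occ c (step d u) → ∃₂ λ s ℓ → 2 ≤ ℓ × ℓ ≤ 4 × Seg c s ℓ
  adjacent-occupied⇒Seg cw  occ occ' = extend 2 refl (s≤s z≤n) (OccupiedRun-extendʳ c (single c occ) occ')
  adjacent-occupied⇒Seg ccw occ occ' = extend 2 refl (s≤s z≤n) (OccupiedRun-extendˡ c (single c occ) occ')

  Seg2? : ∀ s → Dec (Seg c s 2)
  Seg2? s with occ? s | occ? (step cw s) | c (step ccw s) ≟ 0 | c (walk cw s 2) ≟ 0
  ... | yes occ₀ | yes occ₁ | yes freeˡ | yes freeʳ =
    yes (s≤s z≤n , small<n (s≤s (s≤s z≤n)) , OccupiedRun-extendʳ c (single c occ₀) occ₁ , freeˡ , freeʳ)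
  ... | no ¬occ₀ | _ | _ | _ = no λ seg → ¬occ₀ (Seg-occupied c seg 0 z<s)
  ... | _ | no ¬occ₁ | _ | _ = no λ seg → ¬occ₁ (Seg-occupied c seg 1 (s<s z<s))
  ... | _ | _ | no ¬freeˡ | _ = no λ (_ , _ , _ , freeˡ , _) → ¬freeˡ freeˡ
  ... | _ | _ | _ | no ¬freeʳ = no λ (_ , _ , _ , _ , freeʳ) → ¬freeʳ freeʳ

  Seg2-apart : ∀ {a b} → Seg c a 2 → Seg c b 2 → b ≢ step cw a
  Seg2-apart (_ , _ , _ , _ , freeʳ) segᵇ refl = Free⇒¬Occ c freeʳ (Seg-occupied c segᵇ 1 (s<s z<s))

  Seg2⇒Unique2⊎Two2 : ∀ {s} → Seg c s 2 → Unique2 c ⊎ Two2 c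
  Seg2⇒Unique2⊎Two2 {s} segˢ with Finₚ.any? (λ t → ¬? (t F.≟ s) ×-dec Seg2? t)
  ... | no ¬other = inj₁ (s , segˢ , only-s)
    where
      only-s : ∀ t → Seg c t 2 → t ≡ s
      only-s t segᵗ with t F.≟ s
      ... | yes t≡s = t≡s
      ... | no  t≢s = contradiction (t , t≢s , segᵗ) ¬other
  ... | yes (t , t≢s , segᵗ) with Finₚ.any? (λ r → ¬? (r F.≟ s) ×-dec (¬? (r F.≟ t) ×-dec Seg2? r))
  ...   | no ¬third = inj₂ (s , t , ≢-sym t≢s , segˢ , segᵗ , s-or-t)
    where
      s-or-t : ∀ r → Seg c r 2 → r ≡ s ⊎ r ≡ t
      s-or-t r segʳ with r F.≟ s | r F.≟ t
      ... | yes r≡s | _        = inj₁ r≡s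
      ... | no _    | yes r≡t  = inj₂ r≡t
      ... | no r≢s  | no r≢t   = contradiction (r , r≢s , r≢t , segʳ) ¬third
  ...   | yes (r , r≢s , r≢t , segʳ) = contradiction (distinct-occupied≤4 p distinct
          (Seg-occupied c segˢ 0 z<s ∷ Seg-occupied c segˢ 1 (s<s z<s) ∷
           Seg-occupied c segᵗ 0 z<s ∷ Seg-occupied c segᵗ 1 (s<s z<s) ∷ Seg-occupied c segʳ 0 z<s ∷ []))
          1+n≰n
    where
      distinct : Unique (s ∷ step cw s ∷ t ∷ step cw t ∷ r ∷ [])
      distinct =
          (walk-injective cw s z<s (small<n z<s) ∷ ≢-sym t≢s ∷ Seg2-apart segᵗ segˢ ∷ ≢-sym r≢s ∷ [])
        ∷ (Seg2-apart segˢ segᵗ ∘ sym ∷ (λ e → t≢s (sym (step-injective cw e))) ∷ Seg2-apart segˢ segʳ ∘ sym ∷ [])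
        ∷ (walk-injective cw t z<s (small<n z<s) ∷ ≢-sym r≢t ∷ [])
        ∷ (Seg2-apart segᵗ segʳ ∘ sym ∷ [])
        ∷ [] ∷ []

  private
    two-free⇒2≤lmax : ∀ {u} k → Occ c u → Free c (walk cw u (suc k)) → Free c (walk cw u (suc (suc k))) →
                      2 ≤ lmax c
    two-free⇒2≤lmax {u} k occ free₁ free₂ with occ? (walk cw u k)
    ... | yes occₖ = ≤-trans (gap-≥ c cw (walk cw u k) two-free (<⇒≤n∸1 (small<n (s≤s (s≤s z≤n)))))
                             (gap≤lmax c cw _ occₖ)
      where
        two-free : ∀ j → 1 ≤ j → j ≤ 2 → Free c (walk cw (walk cw u k) j)
        two-free 1 _ _ = free₁
        two-free 2 _ _ = free₂
        two-free (suc (suc (suc _))) _ (s≤s (s≤s ()))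
    two-free⇒2≤lmax zero    occ _     _ | no ¬occ = contradiction occ ¬occ
    two-free⇒2≤lmax (suc k) occ free₁ _ | no ¬occ = two-free⇒2≤lmax k occ (¬Occ⇒Free c ¬occ) free₁

    window : ∀ {u} → Occ c u → ∀ i → 2 ≤ lmax c ⊎ ∃ λ o → i < o × o ≤ 2 + i × Occ c (walk cw u o)
    window {u} occ i with occ? (walk cw u (1 + i)) | occ? (walk cw u (2 + i))
    ... | yes occ₁ | _        = inj₂ (1 + i , ≤-refl , n≤1+n _ , occ₁)
    ... | no _     | yes occ₂ = inj₂ (2 + i , n≤1+n _ , ≤-refl , occ₂)
    ... | no ¬occ₁ | no ¬occ₂ = inj₁ (two-free⇒2≤lmax i occ (¬Occ⇒Free c ¬occ₁) (¬Occ⇒Free c ¬occ₂))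

    -- Each of the windows {1,2}, {3,4}, {5,6}, {7,8} after u holds a robot, or is a pair of
    -- free nodes inside a hole of length at least 2; four robots in the windows and u are five.
    occupied⇒2≤lmax : ∀ {u} → Occ c u → 2 ≤ lmax c
    occupied⇒2≤lmax {u} occ with window occ 0 | window occ 2 | window occ 4 | window occ 6
    ... | inj₁ 2≤lmax | _ | _ | _ = 2≤lmax
    ... | _ | inj₁ 2≤lmax | _ | _ = 2≤lmax
    ... | _ | _ | inj₁ 2≤lmax | _ = 2≤lmax
    ... | _ | _ | _ | inj₁ 2≤lmax = 2≤lmax
    ... | inj₂ (o₁ , 0<o₁ , o₁≤2 , occ₁) | inj₂ (o₂ , 2<o₂ , o₂≤4 , occ₂)
        | inj₂ (o₃ , 4<o₃ , o₃≤6 , occ₃) | inj₂ (o₄ , 6<o₄ , o₄≤8 , occ₄) =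
      contradiction (occupied-along≤4 cw u {0 ∷ o₁ ∷ o₂ ∷ o₃ ∷ o₄ ∷ []}
        (0<o₁ ∷ ≤-<-trans o₁≤2 2<o₂ ∷ ≤-<-trans o₂≤4 4<o₃ ∷ ≤-<-trans o₃≤6 6<o₄ ∷ small<n o₄≤8 ∷ [-])
        (occ ∷ occ₁ ∷ occ₂ ∷ occ₃ ∷ occ₄ ∷ []))
        1+n≰n

  2≤lmax : 2 ≤ lmax c
  2≤lmax = occupied⇒2≤lmax (robot⇒Occ p F.zero)

  facing-gaps : ∀ d u → Occ c u → Free c (step d u) → Occ c (walk d u 2) →
                gap c d u ≡ 1 × gap c (opp d) (walk d u 2) ≡ 1
  facing-gaps d u occᵘ free occʷ =
    gap≡1 c d u free occʷ 1<n ,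
    gap≡1 c (opp d) (walk d u 2) (subst (Free c) (sym back₁) free)
      (subst (Occ c) (sym (trans (cong (step (opp d)) back₁) (step-opp-step d u))) occᵘ) 1<n
    where
      1<n = small<n (s≤s z≤n)
      back₁ : step (opp d) (walk d u 2) ≡ step d u
      back₁ = step-opp-step d (step d u)

  -- Offsets along d from u: 1 is free, w's hole covers 3 … 2 + B and ends at 3 + B, u's hole
  -- covers N + 1 … n - 1 and ends at N = n - (1 + A); a robot anywhere else would be a fifth one.
  occupied-around : ∀ d u → Occ c u → Free c (step d u) → Occ c (walk d u 2) →
    gap c (opp d) u < n ∸ 1 → gap c d (walk d u 2) < n ∸ 1 → ∀ z → Occ c z →
    z ∈ u ∷ walk d u 2 ∷ holeEnd c (opp d) u ∷ holeEnd c d (walk d u 2) ∷ []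
  occupied-around d u occᵘ free occʷ A<n∸1 B<n∸1 z occᶻ with walk-surjective d u z
  ... | k , k<n , refl = at k k<n occᶻ
    where
      w = walk d u 2
      A = gap c (opp d) u
      B = gap c d w
      N = n ∸ suc A

      1+A≤n : suc A ≤ n
      1+A≤n = ≤-trans A<n∸1 (m∸n≤m n 1)

      x-at-N : walk d u N ≡ holeEnd c (opp d) u
      x-at-N = sym (walk-opp≡walk-∸ d u (suc A) 1+A≤n)

      y-at-3+B : walk d u (3 + B) ≡ holeEnd c d w
      y-at-3+B = walk-+ d u 2 (suc B)

      n∸1+N≡A : n ∸ suc N ≡ A
      n∸1+N≡A = trans (sym (pred[m∸n]≡m∸[1+n] n N)) (cong pred (m∸[m∸n]≡n 1+A≤n))

      at : ∀ k → k < n → Occ c (walk d u k) → walk d u k ∈ u ∷ w ∷ holeEnd c (opp d) u ∷ holeEnd c d w ∷ []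
      at 0 _ _   = here refl
      at 1 _ occ = contradiction occ (Free⇒¬Occ c free)
      at 2 _ _   = there (here refl)
      at k@(suc (suc (suc j))) k<n occ with k ≤? 2 + B
      ... | yes k≤2+B = contradiction occ (Free⇒¬Occ c (subst (Free c) (sym (walk-+ d u 2 (suc j)))
                          (gap-free c d w (s≤s z≤n) (s≤s⁻¹ (s≤s⁻¹ k≤2+B)))))
      ... | no k≰2+B with k ≟ 3 + B
      ...   | yes k≡3+B = there (there (there (here (trans (cong (walk d u) k≡3+B) y-at-3+B))))
      ...   | no k≢3+B with N <? k
      ...     | yes N<k = contradiction occ (Free⇒¬Occ c (subst (Free c) in-u-hole
                            (gap-free c (opp d) u (m<n⇒0<n∸m k<n) (subst (n ∸ k ≤_) n∸1+N≡A (∸-monoʳ-≤ n N<k)))))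
        where
          in-u-hole : walk (opp d) u (n ∸ k) ≡ walk d u k
          in-u-hole = trans (walk-opp≡walk-∸ d u (n ∸ k) (m∸n≤m n k)) (cong (walk d u) (m∸[m∸n]≡n (<⇒≤ k<n)))
      ...     | no N≮k with k ≟ N
      ...       | yes k≡N = there (there (here (trans (cong (walk d u) k≡N) x-at-N)))
      ...       | no k≢N = contradiction
        (occupied-along≤4 d u {0 ∷ 2 ∷ 3 + B ∷ k ∷ N ∷ []}
          (z<s ∷ s<s (s<s z<s) ∷ ≤∧≢⇒< (≰⇒> k≰2+B) (≢-sym k≢3+B) ∷ ≤∧≢⇒< (≮⇒≥ N≮k) k≢N ∷
           ∸-monoʳ-< z<s 1+A≤n ∷ [-])
          (occᵘ ∷ occʷ ∷ subst (Occ c) (sym y-at-3+B) (gap-blocked c d w B<n∸1) ∷ occ ∷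
           subst (Occ c) (sym x-at-N) (gap-blocked c (opp d) u A<n∸1) ∷ []))
        1+n≰n

  facing-NbL⇒AllNbL : ∀ d u → Occ c u → Free c (step d u) → Occ c (walk d u 2) →
                      NbL c u → NbL c (walk d u 2) → AllNbL c
  facing-NbL⇒AllNbL d u occᵘ free occʷ nbᵘ nbʷ z occᶻ =
    All.lookup (nbᵘ ∷ nbʷ ∷ nbˣ ∷ nbʸ ∷ []) (occupied-around d u occᵘ free occʷ A<n∸1 B<n∸1 z occᶻ)
    where
      w = walk d u 2
      u≢w : u ≢ w
      u≢w = walk-injective d u z<s (small<n (s≤s (s≤s z≤n)))

      A<n∸1 = gap<n∸1 c (opp d) u (≢-sym u≢w) occʷ
      B<n∸1 = gap<n∸1 c d w u≢w occᵘ

      outer : ∀ {a b} → a ≡ lmax c ⊎ b ≡ lmax c → b ≡ 1 → a ≡ lmax c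
      outer (inj₁ a≡lmax) _   = a≡lmax
      outer (inj₂ b≡lmax) b≡1 = contradiction (subst (2 ≤_) (trans (sym b≡lmax) b≡1) 2≤lmax) λ { (s≤s ()) }

      innerᵘ : gap c d u ≡ 1
      innerᵘ = proj₁ (facing-gaps d u occᵘ free occʷ)

      innerʷ : gap c (opp d) w ≡ 1
      innerʷ = proj₂ (facing-gaps d u occᵘ free occʷ)

      nbˣ : NbL c (holeEnd c (opp d) u)
      nbˣ = gap≡lmax⇒NbL c (opp (opp d)) _ (trans (gap-holeEnd c (opp d) u occᵘ A<n∸1)
              (outer (Sum.swap (NbL⇒gap≡lmax c d u nbᵘ)) innerᵘ))

      nbʸ : NbL c (holeEnd c d w)
      nbʸ = gap≡lmax⇒NbL c (opp d) _ (trans (gap-holeEnd c d w occʷ B<n∸1)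
              (outer (NbL⇒gap≡lmax c d w nbʷ) innerʷ))

  module _ (tl : Towerless c) (no4 : ¬ Has4 c) where

    CaseD⇒¬Seg : CaseD c → ∀ {s ℓ} → 2 ≤ ℓ → ℓ ≤ 4 → ¬ Seg c s ℓ
    CaseD⇒¬Seg (_ , ¬unique2 , ¬two2) {ℓ = 2} _ _ seg = [ ¬unique2 , ¬two2 ] (Seg2⇒Unique2⊎Two2 seg)
    CaseD⇒¬Seg (¬seg3 , _ , _) {s} {3} _ _ seg = ¬seg3 (s , seg)
    CaseD⇒¬Seg _ {s} {4} _ _ seg = no4 (s , seg)
    CaseD⇒¬Seg _ {ℓ = 1} (s≤s ()) _ _
    CaseD⇒¬Seg _ {ℓ = suc (suc (suc (suc (suc _))))} _ (s≤s (s≤s (s≤s (s≤s ())))) _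

    CaseD⇒step-free : CaseD c → ∀ {u} → Occ c u → ∀ d → Free c (step d u)
    CaseD⇒step-free caseD {u} occ d with occ? (step d u)
    ... | no ¬occ' = ¬Occ⇒Free c ¬occ'
    ... | yes occ' with adjacent-occupied⇒Seg d occ occ'
    ...   | _ , _ , 2≤ℓ , ℓ≤4 , seg = contradiction seg (CaseD⇒¬Seg caseD 2≤ℓ ℓ≤4)

    -- Only Phase I applies; I(c) and the first sub-case of I(d) both move into a longest hole,
    -- the other two sub-cases of I(d) are merged.
    data Reason (u : Fin n) (d : Dir) : Set where
      toward-3-segment  : HasSeg c 3 → Isolated c u → Reason u d
      toward-2-segment  : ¬ HasSeg c 3 → Unique2 c → Isolated c u →
                          (∃ λ s → Seg c s 2 × (holeEnd c d u ≡ s ⊎ holeEnd c d u ≡ step cw s)) → Reason u d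
      into-longest-hole : Occ c u → gap c d u ≡ lmax c → Reason u d
      case-D            : CaseD c → Occ c u → NbL c u → ¬ AllNbL c → Reason u d

    reason : ∀ {u d} → Instructed c u d → Reason u d
    reason (inj₁ (inj₁ (_ , seg3 , iso , _))) = toward-3-segment seg3 iso
    reason (inj₁ (inj₂ (inj₁ (_ , (¬seg3 , u2) , iso , (s , seg , _ , _ , end))))) =
      toward-2-segment ¬seg3 u2 iso (s , seg , end)
    reason (inj₁ (inj₂ (inj₂ (inj₁ (_ , (caseD , ¬all , _) , occ , nbl , _ , _))))) = case-D caseD occ nbl ¬all
    reason (inj₁ (inj₂ (inj₂ (inj₂ (inj₁ (_ , (caseD , ¬all , _) , occ , nbl , _)))))) = case-D caseD occ nbl ¬all
    reason (inj₁ (inj₂ (inj₂ (inj₂ (inj₂ ((_ , _ , arrow) , _)))))) =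
      contradiction arrow (Towerless⇒¬HasArrow c tl)
    reason (inj₂ (inj₁ (_ , _ , occ , _ , gap≡lmax))) = into-longest-hole occ gap≡lmax
    reason (inj₂ (inj₂ (inj₁ (_ , _ , occ , _ , gap≡lmax)))) = into-longest-hole occ gap≡lmax
    reason (inj₂ (inj₂ (inj₂ ((_ , has4) , _)))) = contradiction has4 no4

    Reason-occupied : ∀ {u d} → Reason u d → Occ c u
    Reason-occupied (toward-3-segment _ iso)     = Isolated-occupied c iso
    Reason-occupied (toward-2-segment _ _ iso _) = Isolated-occupied c iso
    Reason-occupied (into-longest-hole occ _)    = occ
    Reason-occupied (case-D _ occ _ _)           = occ

    target-free : ∀ {u d} → Reason u d → Free c (step d u)
    target-free {d = d} (toward-3-segment _ iso)     = Isolated-free c iso d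
    target-free {d = d} (toward-2-segment _ _ iso _) = Isolated-free c iso d
    target-free {u} {d} (into-longest-hole _ gap≡lmax) =
      gap-free c d u (s≤s z≤n) (≤-trans (n≤1+n 1) (subst (2 ≤_) (sym gap≡lmax) 2≤lmax))
    target-free {d = d} (case-D caseD occ _ _)       = CaseD⇒step-free caseD occ d

    ¬head-on : ∀ {u d} → Reason u d → ¬ Reason (walk d u 2) (opp d)
    ¬head-on {u} {d} rᵘ = clash rᵘ
      where
        w = walk d u 2
        occᵘ = Reason-occupied rᵘ
        free = target-free rᵘ

        short : ∀ {d' v} → gap c d' v ≡ lmax c → gap c d' v ≡ 1 → ⊥
        short gap≡lmax gap≡1 = contradiction (subst (2 ≤_) (trans (sym gap≡lmax) gap≡1) 2≤lmax) λ { (s≤s ()) }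

        clash : Reason u d → Reason w (opp d) → ⊥
        clash (into-longest-hole _ gap≡lmax) rʷ = short gap≡lmax (proj₁ (facing-gaps d u occᵘ free (Reason-occupied rʷ)))
        clash _ (into-longest-hole occʷ gap≡lmax) = short gap≡lmax (proj₂ (facing-gaps d u occᵘ free occʷ))
        clash (toward-3-segment (s , seg) isoᵘ) (toward-3-segment _ isoʷ) = contradiction
          (distinct-occupied≤4 p distinct (Seg-occupied c seg 0 z<s ∷ Seg-occupied c seg 1 (s<s z<s) ∷
                                           Seg-occupied c seg 2 ≤-refl ∷ occᵘ ∷ Isolated-occupied c isoʷ ∷ []))
          1+n≰n
          where
            ∉seg : ∀ {v} → Isolated c v → ∀ k → k < 3 → walk cw s k ≢ v
            ∉seg iso k k<3 = Isolated∉Seg c iso seg (s≤s (s≤s z≤n)) k<3 ∘ sym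

            distinct : Unique (s ∷ walk cw s 1 ∷ walk cw s 2 ∷ u ∷ w ∷ [])
            distinct =
                (walk-injective cw s z<s 1<n ∷ walk-injective cw s z<s 2<n ∷ ∉seg isoᵘ 0 z<s ∷ ∉seg isoʷ 0 z<s ∷ [])
              ∷ (walk-injective cw s (s<s z<s) 2<n ∷ ∉seg isoᵘ 1 (s<s z<s) ∷ ∉seg isoʷ 1 (s<s z<s) ∷ [])
              ∷ (∉seg isoᵘ 2 ≤-refl ∷ ∉seg isoʷ 2 ≤-refl ∷ [])
              ∷ (walk-injective d u z<s 2<n ∷ [])
              ∷ [] ∷ []
              where
                1<n = small<n (s≤s z≤n)
                2<n = small<n (s≤s (s≤s z≤n))
        clash (toward-3-segment seg3 _) (toward-2-segment ¬seg3 _ _ _) = ¬seg3 seg3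
        clash (toward-3-segment seg3 _) (case-D (¬seg3 , _) _ _ _)     = ¬seg3 seg3
        clash (toward-2-segment ¬seg3 _ _ _) (toward-3-segment seg3 _) = ¬seg3 seg3
        clash (case-D (¬seg3 , _) _ _ _) (toward-3-segment seg3 _)     = ¬seg3 seg3
        clash (toward-2-segment _ u2 _ _) (case-D (_ , ¬u2 , _) _ _ _) = ¬u2 u2
        clash (case-D (_ , ¬u2 , _) _ _ _) (toward-2-segment _ u2 _ _) = ¬u2 u2
        clash (toward-2-segment _ _ _ (s , seg , end)) (toward-2-segment _ _ isoʷ _) =
          [ (λ e → Isolated∉Seg c isoʷ seg ≤-refl z<s (trans (sym end≡w) e))
          , (λ e → Isolated∉Seg c isoʷ seg ≤-refl (s<s z<s) (trans (sym end≡w) e)) ] end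
          where
            end≡w : holeEnd c d u ≡ w
            end≡w = cong (λ g → walk d u (suc g)) (proj₁ (facing-gaps d u occᵘ free (Isolated-occupied c isoʷ)))
        clash (case-D _ _ nbᵘ ¬all) (case-D _ occʷ nbʷ _) = ¬all (facing-NbL⇒AllNbL d u occᵘ free occʷ nbᵘ nbʷ)

    targets-distinct : ∀ {u v} d d' → u ≢ v → Instructed c u d → Instructed c v d' → step d u ≢ step d' v
    targets-distinct cw  cw  u≢v _ _ e = u≢v (step-injective cw e)
    targets-distinct ccw ccw u≢v _ _ e = u≢v (step-injective ccw e)
    targets-distinct cw  ccw _ iᵘ iᵛ e = ¬head-on (reason iᵘ) (subst (λ x → Reason x ccw) (opposite-steps-meet cw e) (reason iᵛ))
    targets-distinct ccw cw  _ iᵘ iᵛ e = ¬head-on (reason iᵘ) (subst (λ x → Reason x cw) (opposite-steps-meet ccw e) (reason iᵛ))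

    landing-injective : ∀ {p'} → Step p p' → Injective _≡_ _≡_ p'
    landing-injective {p'} st {i} {j} e with i F.≟ j
    ... | yes i≡j = i≡j
    ... | no  i≢j = contradiction e (apart (step-outcome st i) (step-outcome st j))
      where
        pi≢pj : p i ≢ p j
        pi≢pj = i≢j ∘ Towerless⇒Injective p tl

        apart : ∀ {a b} → (a ≡ p i ⊎ ∃ λ d → Instructed c (p i) d × a ≡ step d (p i)) →
                          (b ≡ p j ⊎ ∃ λ d → Instructed c (p j) d × b ≡ step d (p j)) → a ≢ b
        apart (inj₁ refl) (inj₁ refl) = pi≢pj
        apart (inj₁ refl) (inj₂ (_ , iʲ , refl)) e =
          Free⇒¬Occ c (target-free (reason iʲ)) (subst (Occ c) e (robot⇒Occ p i))
        apart (inj₂ (_ , iⁱ , refl)) (inj₁ refl) e =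
          Free⇒¬Occ c (target-free (reason iⁱ)) (subst (Occ c) (sym e) (robot⇒Occ p j))
        apart (inj₂ (d , iⁱ , refl)) (inj₂ (d' , iʲ , refl)) = targets-distinct d d' pi≢pj iⁱ iʲ

lemma6 : ∀ (n : ℕ) .{{_ : NonZero n}} → 8 < n → (p p' : Pos {n}) →
           Towerless (cfg p) → ¬ Has4 (cfg p) → Step p p' → Towerless (cfg p')
lemma6 n n>8 p p' tl no4 st = Injective⇒Towerless p' (Configuration.landing-injective n>8 p tl no4 st)
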